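{- Let $r\geq 1$ and $k\geq 2$ be integers, and let $\ell_0=\left\lceil \max\left\{\sqrt{\tfrac{k}{2}+1},\ \tfrac{k-1}{r}+2\right\}\right\rceil$. Then for every integer $\ell\geq \ell_0$, $rc_k(K_{\ell^2[r]})=2$.
   Context: For integers $m\geq 1$ and $r\geq 1$, $K_{m[r]}$ denotes the complete $m$-partite graph in which each of the $m$ parts has exactly $r$ vertices. In an edge-colored graph (adjacent edges may receive the same color), a path is rainbow if no two of its edges have the same color. For a $\kappa$-connected graph $G$ and an integer $k$ with $1\leq k\leq\kappa$, the rainbow $k$-connectivity $rc_k(G)$ is the minimum integer $j$ such that there is an edge-coloring of $G$ with $j$ colors in which every two distinct vertices $u,v$ are connected by at least $k$ internally disjoint rainbow $u$–$v$ paths. -}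

module Defs where

open import Level using (0ℓ)
open import Data.Nat using (ℕ; zero; suc; _+_; _*_; _≤_; _<_)
open import Data.Fin using (Fin)
open import Data.Product using (Σ; ∃; _×_; _,_; proj₁)
open import Data.List using (List; []; _∷_)
open import Data.List.Membership.Propositional using (_∈_)
open import Data.List.Relation.Unary.Unique.Propositional using (Unique)
open import Data.Empty using (⊥)
open import Relation.Nullary using (¬_)
open import Relation.Binary.PropositionalEquality using (_≡_; _≢_)

-- A (simple, undirected) graph: a vertex type with a symmetric irreflexive
-- adjacency relation (symmetry/irreflexivity are properties of the concrete graph below).
record Graph : Set₁ where
  field
    V   : Set
    Adj : V → V → Set
open Graph public

K[_][_] : ℕ → ℕ → Graph
K[ m ][ r ] = record
  { V = Fin m × Fin r
  ; Adj = λ { (a , _) (b , _) → a ≢ b } }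

module _ (G : Graph) where
  private
    W = V G

  data Walk : W → W → List W → Set where
    here : ∀ {u} → Walk u u (u ∷ [])
    step : ∀ {u w v xs} → Adj G u w → Walk w v xs → Walk u v (u ∷ xs)

  IsPath : W → W → List W → Set
  IsPath u v xs = Walk u v xs × Unique xs

  edgeColors : {C : Set} → (W → W → C) → List W → List C
  edgeColors c [] = []
  edgeColors c (x ∷ []) = []
  edgeColors c (x ∷ y ∷ ys) = c x y ∷ edgeColors c (y ∷ ys)

  IsRainbowPath : {C : Set} → (W → W → C) → W → W → List W → Set
  IsRainbowPath c u v xs = IsPath u v xs × Unique (edgeColors c xs)

  dropLast : List W → List W
  dropLast [] = []
  dropLast (x ∷ []) = []
  dropLast (x ∷ y ∷ ys) = x ∷ dropLast (y ∷ ys)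

  interior : List W → List W
  interior [] = []
  interior (x ∷ ys) = dropLast ys

  InternallyDisjoint : List W → List W → Set
  InternallyDisjoint p q = ∀ x → x ∈ interior p → x ∈ interior q → ⊥

  -- An edge-coloring of G with j colors (colors of edges are given by c u v
  -- for adjacent u, v; c must not depend on the orientation of the edge).
  EdgeColoring : ℕ → Set
  EdgeColoring j = Σ (W → W → Fin j) λ c → ∀ u v → Adj G u v → c u v ≡ c v u

  RainbowKConnected : (k : ℕ) {j : ℕ} → (W → W → Fin j) → Set
  RainbowKConnected k c =
    ∀ u v → u ≢ v →
      Σ (Fin k → List W) λ ps →
        (∀ i → IsRainbowPath c u v (ps i)) ×
        (∀ i i' → i ≢ i' → (ps i ≢ ps i') × InternallyDisjoint (ps i) (ps i'))

  RCColorable : ℕ → ℕ → Set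
  RCColorable k j = Σ (EdgeColoring j) λ c → RainbowKConnected k (proj₁ c)


rc_⟨_⟩≡_ : ℕ → Graph → ℕ → Set
rc k ⟨ G ⟩≡ j = RCColorable G k j × (∀ j' → j' < j → ¬ RCColorable G k j')

-- Identify the ℓ² parts with the grid Fin ℓ × Fin ℓ and colour the edge between (P, i) and
-- (Q, j) by the parity of  [i = j] + [P and Q share their first coordinate]
--                                 + [P and Q share their second coordinate].
-- Two vertices of one part are joined through any vertex (R, i) or (R, j) with R ≠ P,
-- giving 2(ℓ² − 1) ≥ k rainbow paths of length two.  For vertices of different parts P, Q
-- the direct edge is one path, and for every index m there are ℓ − 2 parts R ∉ {P, Q} whose
-- relation to P and to Q has whichever parity makes P–(R, m)–Q rainbow; this gives
-- 1 + r(ℓ − 2) ≥ k paths.  Two colours are also necessary: with one colour the only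
-- rainbow path between two vertices is the edge joining them.
module Submission where

open import Defs
open import Data.Bool using (Bool; true; false; not; _xor_)
open import Data.Bool.Properties using (xor-same; not-¬)
open import Data.Fin using (Fin; zero; suc; punchIn; punchOut; fromℕ<; _≟_)
open import Data.Fin.Properties
  using (¬Fin0; 2↔Bool; *↔×; punchIn-injective; punchInᵢ≢i; punchIn-punchOut; inject≤-injective)
open import Data.List using (List; []; _∷_)
open import Data.List.Properties using (∷-injectiveˡ; ∷-injectiveʳ)
open import Data.List.Relation.Unary.All using ([]; _∷_)
open import Data.List.Relation.Unary.AllPairs using ([]; _∷_)
open import Data.List.Relation.Unary.Any using (here)
open import Data.Nat using (ℕ; zero; suc; pred; _+_; _*_; _≤_; _<_; s≤s; z≤n)
open import Data.Nat.Properties using (+-cancelʳ-≤; +-comm; +-monoˡ-≤; *-suc; ≤-trans; m+n≤o⇒n≤o)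
open import Data.Nat.Solver using (module +-*-Solver)
open import Data.Product using (Σ; Σ-syntax; _×_; _,_; proj₁; proj₂)
open import Data.Product.Properties using (,-injectiveˡ; ,-injectiveʳ)
open import Function using (_∘_)
open import Function.Bundles using (Inverse; Injection; _↔_; _↣_; mk↣)
open import Function.Construct.Composition using (_↣-∘_)
open import Function.Definitions using (Injective)
open import Function.Properties.Inverse using (↔-sym; ↔⇒↣)
open import Relation.Binary.Definitions using (DecidableEquality)
open import Relation.Binary.PropositionalEquality
  using (_≡_; _≢_; refl; sym; trans; cong; cong₂; subst)
open import Relation.Nullary using (¬_; does; yes; no; contradiction)
open import Relation.Nullary.Decidable using (dec-true; dec-false)

open Injection using (injective)

private
  variable
    k m n : ℕ

does-≟-sym : {A : Set} (_≟ᴬ_ : DecidableEquality A) (x y : A) → does (x ≟ᴬ y) ≡ does (y ≟ᴬ x)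
does-≟-sym _≟ᴬ_ x y with x ≟ᴬ y
... | yes refl = sym (dec-true (x ≟ᴬ x) refl)
... | no x≢y = sym (dec-false (y ≟ᴬ x) (x≢y ∘ sym))

xor-exchange : ∀ x y X Y → x xor X ≡ y xor Y → x xor y ≡ X xor Y
xor-exchange false false false false _ = refl
xor-exchange false false true  true  _ = refl
xor-exchange false true  false true  _ = refl
xor-exchange false true  true  false _ = refl
xor-exchange true  false false true  _ = refl
xor-exchange true  false true  false _ = refl
xor-exchange true  true  false false _ = refl
xor-exchange true  true  true  true  _ = refl
xor-exchange false false false true  ()
xor-exchange false false true  false ()
xor-exchange false true  false false ()
xor-exchange false true  true  true  ()
xor-exchange true  false false false ()
xor-exchange true  false true  true  ()
xor-exchange true  true  false true  ()
xor-exchange true  true  true  false ()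

Bool↣Fin2 : Bool ↣ Fin 2
Bool↣Fin2 = ↔⇒↣ (↔-sym 2↔Bool)

≤*⇒↣× : k ≤ m * n → Fin k ↣ (Fin m × Fin n)
≤*⇒↣× k≤mn = ↔⇒↣ *↔× ↣-∘ mk↣ (inject≤-injective k≤mn k≤mn _ _)

-- punchIn₂ x y enumerates the complement of {x, y}; when x ≡ y one further value is skipped.
punchIn₂ : Fin (suc (suc n)) → Fin (suc (suc n)) → Fin n → Fin (suc (suc n))
punchIn₂ x y with x ≟ y
... | yes _ = punchIn x ∘ punchIn zero
... | no x≢y = punchIn x ∘ punchIn (punchOut x≢y)

punchIn₂ᵢⱼ≢i : ∀ x y (t : Fin n) → punchIn₂ x y t ≢ x
punchIn₂ᵢⱼ≢i x y t with x ≟ y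
... | yes _ = punchInᵢ≢i x _
... | no _ = punchInᵢ≢i x _

punchIn₂ᵢⱼ≢j : ∀ x y (t : Fin n) → punchIn₂ x y t ≢ y
punchIn₂ᵢⱼ≢j x y t with x ≟ y
... | yes refl = punchInᵢ≢i x _
... | no x≢y = λ e → punchInᵢ≢i (punchOut x≢y) t
                       (punchIn-injective x _ _ (trans e (sym (punchIn-punchOut x≢y))))

punchIn₂-injective : ∀ x y (t t′ : Fin n) → punchIn₂ x y t ≡ punchIn₂ x y t′ → t ≡ t′
punchIn₂-injective x y t t′ e with x ≟ y
... | yes _ = punchIn-injective zero _ _ (punchIn-injective x _ _ e)
... | no _ = punchIn-injective _ _ _ (punchIn-injective x _ _ e)

Fin1-≡ : (a b : Fin 1) → a ≡ b
Fin1-≡ zero zero = refl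

module _ (G : Graph) where

  RainbowLinked : ℕ → {C : Set} → (V G → V G → C) → V G → V G → Set
  RainbowLinked k c u v =
    Σ (Fin k → List (V G)) λ ps →
      (∀ t → IsRainbowPath G c u v (ps t)) ×
      (∀ t t′ → t ≢ t′ → (ps t ≢ ps t′) × InternallyDisjoint G (ps t) (ps t′))

  rainbowPath-oneColour : (c : V G → V G → Fin 1) {u v : V G} {xs : List (V G)} →
    u ≢ v → IsRainbowPath G c u v xs → xs ≡ u ∷ v ∷ []
  rainbowPath-oneColour c u≢v ((here , _) , _) = contradiction refl u≢v
  rainbowPath-oneColour c u≢v ((step _ here , _) , _) = refl
  rainbowPath-oneColour c u≢v ((step _ (step _ here) , _) , ((c₁≢c₂ ∷ _) ∷ _)) =
    contradiction (Fin1-≡ _ _) c₁≢c₂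
  rainbowPath-oneColour c u≢v ((step _ (step _ (step _ _)) , _) , ((c₁≢c₂ ∷ _) ∷ _)) =
    contradiction (Fin1-≡ _ _) c₁≢c₂

  ¬rcColorable-<2 : {u v : V G} {j : ℕ} → u ≢ v → 2 ≤ k → j < 2 → ¬ RCColorable G k j
  ¬rcColorable-<2 {u = u} {j = zero} _ _ _ ((c , _) , _) = ¬Fin0 (c u u)
  ¬rcColorable-<2 {u = u} {v} {suc zero} u≢v (s≤s (s≤s _)) _ ((c , _) , linked)
    with ps , rainbow , distinct ← linked u v u≢v =
    proj₁ (distinct zero (suc zero) λ ())
      (trans (rainbowPath-oneColour c u≢v (rainbow zero))
             (sym (rainbowPath-oneColour c u≢v (rainbow (suc zero)))))
  ¬rcColorable-<2 {j = suc (suc _)} _ _ (s≤s (s≤s ()))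

  rc≡2 : {u v : V G} → u ≢ v → 2 ≤ k → RCColorable G k 2 → rc k ⟨ G ⟩≡ 2
  rc≡2 u≢v 2≤k colourable = colourable , λ j j<2 → ¬rcColorable-<2 u≢v 2≤k j<2

module _ (G : Graph) (adj⇒≢ : ∀ {u v} → Adj G u v → u ≢ v) {C : Set} (c : V G → V G → C) where

  record RainbowMidpoint (u w v : V G) : Set where
    constructor mkRainbowMidpoint
    field
      adjˡ : Adj G u w
      adjʳ : Adj G w v
      colours≢ : c u w ≢ c w v

  private
    via : V G → V G → V G → List (V G)
    via u w v = u ∷ w ∷ v ∷ []

    via-rainbow : ∀ {u w v} → u ≢ v → RainbowMidpoint u w v → IsRainbowPath G c u v (via u w v)
    via-rainbow u≢v (mkRainbowMidpoint uw wv c≢) =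
      (step uw (step wv here) , (adj⇒≢ uw ∷ u≢v ∷ []) ∷ (adj⇒≢ wv ∷ []) ∷ [] ∷ []) ,
      (c≢ ∷ []) ∷ [] ∷ []

    edge-rainbow : ∀ {u v} → Adj G u v → IsRainbowPath G c u v (u ∷ v ∷ [])
    edge-rainbow uv = (step uv here , (adj⇒≢ uv ∷ []) ∷ [] ∷ []) , [] ∷ []

    via-≢ : ∀ {u w w′ v} → w ≢ w′ → via u w v ≢ via u w′ v
    via-≢ w≢w′ = w≢w′ ∘ ∷-injectiveˡ ∘ ∷-injectiveʳ

    via-disjoint : ∀ u v {w w′} → w ≢ w′ → InternallyDisjoint G (via u w v) (via u w′ v)
    via-disjoint _ _ w≢w′ _ (here refl) (here refl) = w≢w′ refl

  rainbowLinked-viaMidpoints : ∀ {u v} → u ≢ v → (g : Fin k ↣ V G) →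
    (∀ t → RainbowMidpoint u (Injection.to g t) v) → RainbowLinked G k c u v
  rainbowLinked-viaMidpoints {u = u} {v} u≢v g mid =
    (λ t → via u (to t) v) , (λ t → via-rainbow u≢v (mid t)) ,
    λ t t′ t≢t′ → via-≢ (λ e → t≢t′ (injective g e)) , via-disjoint u v (λ e → t≢t′ (injective g e))
    where open Injection g using (to)

  rainbowLinked-viaEdgeAndMidpoints : ∀ {u v} → Adj G u v → (g : Fin k ↣ V G) →
    (∀ t → RainbowMidpoint u (Injection.to g t) v) → RainbowLinked G (suc k) c u v
  rainbowLinked-viaEdgeAndMidpoints {k} {u} {v} uv g mid = paths , rainbow , distinct
    where
    open Injection g using (to)

    paths : Fin (suc k) → List (V G)
    paths zero = u ∷ v ∷ []
    paths (suc t) = via u (to t) v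

    rainbow : ∀ t → IsRainbowPath G c u v (paths t)
    rainbow zero = edge-rainbow uv
    rainbow (suc t) = via-rainbow (adj⇒≢ uv) (mid t)

    distinct : ∀ t t′ → t ≢ t′ → (paths t ≢ paths t′) × InternallyDisjoint G (paths t) (paths t′)
    distinct zero zero t≢t′ = contradiction refl t≢t′
    distinct zero (suc _) _ = (λ ()) , λ _ ()
    distinct (suc _) zero _ = (λ ()) , λ _ _ ()
    distinct (suc t) (suc t′) t≢t′ =
      via-≢ (λ e → t≢t′ (cong suc (injective g e))) ,
      via-disjoint u v (λ e → t≢t′ (cong suc (injective g e)))

Witness : {A : Set} → (A → A → Bool) → A → A → Bool → A → Set
Witness χ P Q β R = R ≢ P × R ≢ Q × (χ P R xor χ Q R) ≡ β

HasWitnesses : {A : Set} → (A → A → Bool) → ℕ → Set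
HasWitnesses {A} χ n =
  ∀ {P Q} → P ≢ Q → ∀ β → Σ[ R ∈ Fin n ↣ A ] ∀ s → Witness χ P Q β (Injection.to R s)

hasWitnesses-↔ : {A B : Set} (e : A ↔ B) {χ : B → B → Bool} →
  HasWitnesses χ n → HasWitnesses (λ x y → χ (Inverse.to e x) (Inverse.to e y)) n
hasWitnesses-↔ {n} {B = B} e {χ} witnesses {P} {Q} P≢Q β =
  ↔⇒↣ (↔-sym e) ↣-∘ R , λ s → witness (R-witness s)
  where
  open Inverse e using (to; from; strictlyInverseˡ; strictlyInverseʳ)
  toP≢toQ : to P ≢ to Q
  toP≢toQ eq = P≢Q (trans (sym (strictlyInverseʳ P)) (trans (cong from eq) (strictlyInverseʳ Q)))

  R : Fin n ↣ B
  R = proj₁ (witnesses toP≢toQ β)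

  R-witness : ∀ s → Witness χ (to P) (to Q) β (Injection.to R s)
  R-witness = proj₂ (witnesses toP≢toQ β)

  from-≢ : ∀ {X Y} → X ≢ to Y → from X ≢ Y
  from-≢ {X} X≢ eq = X≢ (trans (sym (strictlyInverseˡ X)) (cong to eq))

  witness : ∀ {X} → Witness χ (to P) (to Q) β X → Witness (λ x y → χ (to x) (to y)) P Q β (from X)
  witness {X} (X≢P , X≢Q , parity) =
    from-≢ X≢P , from-≢ X≢Q ,
    subst (λ Y → (χ (to P) Y xor χ (to Q) Y) ≡ β) (sym (strictlyInverseˡ X)) parity

agreeInOneCoordinate : Fin n × Fin n → Fin n × Fin n → Bool
agreeInOneCoordinate (a , b) (a′ , b′) = does (a ≟ a′) xor does (b ≟ b′)

agreeInOneCoordinate-sym : ∀ (P Q : Fin n × Fin n) →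
  agreeInOneCoordinate P Q ≡ agreeInOneCoordinate Q P
agreeInOneCoordinate-sym (a , b) (a′ , b′) = cong₂ _xor_ (does-≟-sym _≟_ a a′) (does-≟-sym _≟_ b b′)

agree-sameFirst : ∀ (a : Fin n) {b y} → y ≢ b → agreeInOneCoordinate (a , b) (a , y) ≡ true
agree-sameFirst a {b} {y} y≢b = cong₂ _xor_ (dec-true (a ≟ a) refl) (dec-false (b ≟ y) (y≢b ∘ sym))

agree-sameSecond : ∀ (b : Fin n) {a x} → x ≢ a → agreeInOneCoordinate (a , b) (x , b) ≡ true
agree-sameSecond b {a} {x} x≢a = cong₂ _xor_ (dec-false (a ≟ x) (x≢a ∘ sym)) (dec-true (b ≟ b) refl)

agree-neither : {a b x y : Fin n} → x ≢ a → y ≢ b → agreeInOneCoordinate (a , b) (x , y) ≡ false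
agree-neither {a = a} {b} {x} {y} x≢a y≢b =
  cong₂ _xor_ (dec-false (a ≟ x) (x≢a ∘ sym)) (dec-false (b ≟ y) (y≢b ∘ sym))

-- Witnesses of parity false differ from P and Q in both coordinates; witnesses of parity
-- true share one coordinate with exactly one of P, Q.
agreeInOneCoordinate-hasWitnesses : HasWitnesses (agreeInOneCoordinate {suc (suc n)}) n
agreeInOneCoordinate-hasWitnesses {P = a , b} {a′ , b′} _ false =
  mk↣ {to = λ s → punchIn₂ a a′ s , punchIn₂ b b′ s} (punchIn₂-injective a a′ _ _ ∘ ,-injectiveˡ) ,
  λ s → (punchIn₂ᵢⱼ≢i a a′ s ∘ ,-injectiveˡ) , (punchIn₂ᵢⱼ≢j a a′ s ∘ ,-injectiveˡ) ,
        cong₂ _xor_ (agree-neither (punchIn₂ᵢⱼ≢i a a′ s) (punchIn₂ᵢⱼ≢i b b′ s))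
                    (agree-neither (punchIn₂ᵢⱼ≢j a a′ s) (punchIn₂ᵢⱼ≢j b b′ s))
agreeInOneCoordinate-hasWitnesses {P = a , b} {a′ , b′} P≢Q true with a ≟ a′
... | yes refl =
  mk↣ {to = λ s → punchIn₂ a a s , b} (punchIn₂-injective a a _ _ ∘ ,-injectiveˡ) ,
  λ s → (punchIn₂ᵢⱼ≢i a a s ∘ ,-injectiveˡ) , (punchIn₂ᵢⱼ≢j a a s ∘ ,-injectiveˡ) ,
        cong₂ _xor_ (agree-sameSecond b (punchIn₂ᵢⱼ≢i a a s))
                    (agree-neither (punchIn₂ᵢⱼ≢j a a s) (P≢Q ∘ cong (a ,_)))
... | no a≢a′ =
  mk↣ {to = λ s → a , punchIn₂ b b′ s} (punchIn₂-injective b b′ _ _ ∘ ,-injectiveʳ) ,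
  λ s → (punchIn₂ᵢⱼ≢i b b′ s ∘ ,-injectiveʳ) , (a≢a′ ∘ ,-injectiveˡ) ,
        cong₂ _xor_ (agree-sameFirst a (punchIn₂ᵢⱼ≢i b b′ s))
                    (agree-neither a≢a′ (punchIn₂ᵢⱼ≢j b b′ s))

module Multipartite {N r : ℕ} (χ : Fin (suc N) → Fin (suc N) → Bool)
                    (χ-sym : ∀ P Q → χ P Q ≡ χ Q P) where

  G : Graph
  G = K[ suc N ][ r ]

  Vertex : Set
  Vertex = V G

  colour : Vertex → Vertex → Fin 2
  colour (P , i) (Q , j) = Injection.to Bool↣Fin2 (does (i ≟ j) xor χ P Q)

  colouring : EdgeColoring G 2
  colouring = colour , λ { (P , i) (Q , j) _ →
    cong (Injection.to Bool↣Fin2) (cong₂ _xor_ (does-≟-sym _≟_ i j) (χ-sym P Q)) }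

  adj⇒≢ : ∀ {u v} → Adj G u v → u ≢ v
  adj⇒≢ P≢Q = P≢Q ∘ ,-injectiveˡ

  rainbowMidpoint-byParity : ∀ {P Q R i j m} → R ≢ P → R ≢ Q →
    (does (i ≟ m) xor does (j ≟ m)) ≢ (χ P R xor χ Q R) →
    RainbowMidpoint G adj⇒≢ colour (P , i) (R , m) (Q , j)
  rainbowMidpoint-byParity {P} {Q} {R} {i} {j} {m} R≢P R≢Q parity≢ =
    mkRainbowMidpoint (R≢P ∘ sym) R≢Q
    λ e → parity≢ (xor-exchange (does (i ≟ m)) (does (j ≟ m)) (χ P R) (χ Q R)
      (trans (injective Bool↣Fin2 e) (cong₂ _xor_ (does-≟-sym _≟_ m j) (χ-sym R Q))))

  rainbowLinked-samePart : ∀ {P i j} → i ≢ j → k ≤ 2 * N →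
    RainbowLinked G k colour (P , i) (P , j)
  rainbowLinked-samePart {k} {P} {i} {j} i≢j k≤2N =
    rainbowLinked-viaMidpoints G adj⇒≢ colour (i≢j ∘ ,-injectiveʳ)
      (midpoints ↣-∘ ≤*⇒↣× k≤2N) (midpoint ∘ Injection.to (≤*⇒↣× k≤2N))
    where
    endpoint : Fin 2 → Fin r
    endpoint zero = i
    endpoint (suc zero) = j

    endpoint-injective : Injective _≡_ _≡_ endpoint
    endpoint-injective {zero} {zero} _ = refl
    endpoint-injective {zero} {suc zero} e = contradiction e i≢j
    endpoint-injective {suc zero} {zero} e = contradiction (sym e) i≢j
    endpoint-injective {suc zero} {suc zero} _ = refl

    endpoint-parity : ∀ b → does (i ≟ endpoint b) xor does (j ≟ endpoint b) ≡ true
    endpoint-parity zero rewrite dec-true (i ≟ i) refl | dec-false (j ≟ i) (i≢j ∘ sym) = refl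
    endpoint-parity (suc zero) rewrite dec-false (i ≟ j) i≢j | dec-true (j ≟ j) refl = refl

    midpointAt : Fin 2 × Fin N → Vertex
    midpointAt (b , s) = punchIn P s , endpoint b

    midpointAt-injective : Injective _≡_ _≡_ midpointAt
    midpointAt-injective e =
      cong₂ _,_ (endpoint-injective (,-injectiveʳ e)) (punchIn-injective P _ _ (,-injectiveˡ e))

    midpoints : (Fin 2 × Fin N) ↣ Vertex
    midpoints = mk↣ midpointAt-injective

    midpoint : ∀ x → RainbowMidpoint G adj⇒≢ colour (P , i) (midpointAt x) (P , j)
    midpoint (b , s) = rainbowMidpoint-byParity (punchInᵢ≢i P s) (punchInᵢ≢i P s)
      λ e → contradiction (trans (sym (endpoint-parity b)) (trans e (xor-same (χ P (punchIn P s))))) λ ()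

  rainbowLinked-differentParts : HasWitnesses χ n → ∀ {P Q i j} → P ≢ Q → k ≤ suc (r * n) →
    RainbowLinked G k colour (P , i) (Q , j)
  rainbowLinked-differentParts _ _ z≤n = (λ ()) , (λ ()) , λ ()
  rainbowLinked-differentParts {n} witnesses {P} {Q} {i} {j} P≢Q (s≤s k≤rn) =
    rainbowLinked-viaEdgeAndMidpoints G adj⇒≢ colour P≢Q
      (midpoints ↣-∘ ≤*⇒↣× k≤rn) (midpoint ∘ Injection.to (≤*⇒↣× k≤rn))
    where
    parity : Fin r → Bool
    parity m = does (i ≟ m) xor does (j ≟ m)

    R : Fin r → Fin n ↣ Fin (suc N)
    R m = proj₁ (witnesses P≢Q (not (parity m)))

    midpointAt : Fin r × Fin n → Vertex
    midpointAt (m , s) = Injection.to (R m) s , m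

    midpointAt-injective : Injective _≡_ _≡_ midpointAt
    midpointAt-injective {m , _} e with refl ← ,-injectiveʳ e =
      cong (m ,_) (injective (R m) (,-injectiveˡ e))

    midpoints : (Fin r × Fin n) ↣ Vertex
    midpoints = mk↣ midpointAt-injective

    midpoint : ∀ x → RainbowMidpoint G adj⇒≢ colour (P , i) (midpointAt x) (Q , j)
    midpoint (m , s) with R≢P , R≢Q , opposite ← proj₂ (witnesses P≢Q (not (parity m))) s =
      rainbowMidpoint-byParity R≢P R≢Q λ e → not-¬ refl (trans e opposite)

  rainbowKConnected : HasWitnesses χ n → k ≤ 2 * N → k ≤ suc (r * n) → RainbowKConnected G k colour
  rainbowKConnected witnesses k≤2N k≤1+rn (P , i) (Q , j) u≢v with P ≟ Q
  ... | yes refl = rainbowLinked-samePart (u≢v ∘ cong (P ,_)) k≤2N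
  ... | no P≢Q = rainbowLinked-differentParts witnesses P≢Q k≤1+rn

m+2≤2*n⇒m≤2*pred[n] : k + 2 ≤ 2 * n → k ≤ 2 * pred n
m+2≤2*n⇒m≤2*pred[n] {k} {zero} h = contradiction (m+n≤o⇒n≤o k h) λ ()
m+2≤2*n⇒m≤2*pred[n] {k} {suc n} h =
  +-cancelʳ-≤ 2 k (2 * n) (subst (k + 2 ≤_) (trans (*-suc 2 n) (+-comm 2 (2 * n))) h)

m+2r≤r*[2+n]+1⇒m≤1+r*n : ∀ r → k + 2 * r ≤ r * suc (suc n) + 1 → k ≤ suc (r * n)
m+2r≤r*[2+n]+1⇒m≤1+r*n {k} {n} r h = +-cancelʳ-≤ (2 * r) k (suc (r * n)) (subst (k + 2 * r ≤_) eq h)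
  where
  open +-*-Solver using (solve; _:*_; _:+_; con; _:=_)
  eq : r * suc (suc n) + 1 ≡ suc (r * n) + 2 * r
  eq = solve 2 (λ r n → r :* (con 2 :+ n) :+ con 1 := con 1 :+ r :* n :+ con 2 :* r) refl r n

theorem2 : (r k ℓ : ℕ) → 1 ≤ r → 2 ≤ k →
    k + 2 ≤ 2 * (ℓ * ℓ) → k + 2 * r ≤ r * ℓ + 1 →
    rc k ⟨ K[ ℓ * ℓ ][ r ] ⟩≡ 2
theorem2 r k 0 _ 2≤k k≤2ℓ² _ = contradiction (≤-trans {4} (+-monoˡ-≤ 2 2≤k) k≤2ℓ²) λ ()
theorem2 r k 1 _ 2≤k k≤2ℓ² _ = contradiction (≤-trans {4} (+-monoˡ-≤ 2 2≤k) k≤2ℓ²) λ { (s≤s (s≤s ())) }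
theorem2 r k ℓ@(suc (suc n)) 1≤r 2≤k k≤2ℓ² k≤rℓ =
  rc≡2 G {u = zero , fromℕ< 1≤r} {v = suc zero , fromℕ< 1≤r} (λ ()) 2≤k
    (colouring ,
     rainbowKConnected (hasWitnesses-↔ grid {agreeInOneCoordinate} agreeInOneCoordinate-hasWitnesses)
       (m+2≤2*n⇒m≤2*pred[n] {n = ℓ * ℓ} k≤2ℓ²) (m+2r≤r*[2+n]+1⇒m≤1+r*n r k≤rℓ))
  where
  grid : Fin (ℓ * ℓ) ↔ (Fin ℓ × Fin ℓ)
  grid = *↔×

  gridParity : Fin (ℓ * ℓ) → Fin (ℓ * ℓ) → Bool
  gridParity P Q = agreeInOneCoordinate (Inverse.to grid P) (Inverse.to grid Q)

  open Multipartite {r = r} gridParity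
    (λ P Q → agreeInOneCoordinate-sym (Inverse.to grid P) (Inverse.to grid Q))
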